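{- Let $q\ge3$, $p=-1$, and set $a=\lceil q/2\rceil$ and $b=\lceil q^2/(6q-2)\rceil$. For odd $q$ put $E=1$, $A=(q-1)\tau+(a-1)q-1$, $F=(q-a)\tau+q-a$, $B=-a\tau+1-a$, $G=(q-a)\tau+1-a$; for even $q$ put $E=1$, $A=(a+b)\tau+(a-1)q+1$, $F=(q-a-1)\tau-q+b$, $B=-a\tau-aq+1$, $G=(a-1)\tau+(a-1)q+1$. Then $A\tau^2+B=E\tau^6+F\tau^3+G$, and $A,B,E,F,G$ all belong to the minimal norm digit set modulo $\tau^3$, so both sides are valid digit expansions; in particular the $3$-NAF is not a minimal (optimal) digit expansion.
   Context: $\tau=\frac p2+i\sqrt{q-\frac14}$ is a root of $X^2-pX+q$ and $\mathbb{Z}[\tau]=\{x+y\tau:x,y\in\mathbb{Z}\}$. The minimal norm digit set modulo $\tau^w$ is the set consisting of $0$ together with, for each residue class of $\mathbb{Z}[\tau]$ modulo $\tau^w$ not divisible by $\tau$, its (unique) representative of minimal absolute value. Digit expansions, the $w$-NAF (in every block of $w$ consecutive digits at most one is nonzero), weight (number of nonzero digits) and optimality (minimal weight among all expansions of the same element with digits in the digit set) are as usual; the $w$-NAF is minimal if the $w$-NAF of every element of $\mathbb{Z}[\tau]$ is optimal. -}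

module Defs where

open import Data.Nat as ℕ using (ℕ; zero; suc; _/_; _%_)
open import Data.Integer as ℤ using (ℤ; +_; -_; _+_; _-_; _*_; _≤_; _<_)
open import Data.List using (List; []; _∷_; length; filter)
open import Data.List.Relation.Unary.All using (All)
open import Data.Product using (_×_; Σ; ∃)
open import Data.Sum using (_⊎_)
open import Relation.Binary.PropositionalEquality using (_≡_; _≢_)
open import Relation.Nullary using (¬_)

-- Elements x + y τ of ℤ[τ], where τ is a root of X² - pX + q.
record Zτ : Set where
  constructor mk
  field
    re : ℤ
    im : ℤ
open Zτ public

𝟘 : Zτ
𝟘 = mk (+ 0) (+ 0)

𝟙 : Zτ
𝟙 = mk (+ 1) (+ 0)

τ : Zτ
τ = mk (+ 0) (+ 1)

_⊕_ : Zτ → Zτ → Zτ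
mk a b ⊕ mk c d = mk (a + c) (b + d)

_⊖_ : Zτ → Zτ → Zτ
mk a b ⊖ mk c d = mk (a - c) (b - d)

-- multiplication in ℤ[τ] using τ² = pτ - q
mul : (p q : ℤ) → Zτ → Zτ → Zτ
mul p q (mk a b) (mk c d) = mk (a * c - q * (b * d)) (a * d + b * c + p * (b * d))

pow : (p q : ℤ) → Zτ → ℕ → Zτ
pow p q z zero = 𝟙
pow p q z (suc n) = mul p q z (pow p q z n)

-- squared absolute value |x + yτ|² = x² + pxy + qy²
norm : (p q : ℤ) → Zτ → ℤ
norm p q (mk x y) = x * x + p * (x * y) + q * (y * y)

Divides : (p q : ℤ) → Zτ → Zτ → Set
Divides p q d z = Σ Zτ λ c → z ≡ mul p q d c

InDigitSet : (p q : ℤ) (w : ℕ) → Zτ → Set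
InDigitSet p q w d =
  d ≡ 𝟘 ⊎
  ((¬ Divides p q τ d) ×
   (∀ z → Divides p q (pow p q τ w) (z ⊖ d) → z ≢ d → norm p q d < norm p q z))

-- digit expansions: little-endian lists of digits, value = Σ dᵢ τ^i
value : (p q : ℤ) → List Zτ → Zτ
value p q [] = 𝟘
value p q (d ∷ ds) = d ⊕ mul p q τ (value p q ds)

IsExpansion : (p q : ℤ) (w : ℕ) → List Zτ → Set
IsExpansion p q w ds = All (InDigitSet p q w) ds

digitAt : List Zτ → ℕ → Zτ
digitAt [] i = 𝟘
digitAt (d ∷ ds) zero = d
digitAt (d ∷ ds) (suc i) = digitAt ds i

weight : List Zτ → ℕ
weight [] = 0
weight (mk (+ 0) (+ 0) ∷ ds) = weight ds
weight (_ ∷ ds) = suc (weight ds)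

IsNAF : ℕ → List Zτ → Set
IsNAF w ds = ∀ i j → i ℕ.< j → j ℕ.< i ℕ.+ w → digitAt ds i ≡ 𝟘 ⊎ digitAt ds j ≡ 𝟘

IsOptimal : (p q : ℤ) (w : ℕ) → List Zτ → Set
IsOptimal p q w ds =
  ∀ es → IsExpansion p q w es → value p q es ≡ value p q ds → weight ds ℕ.≤ weight es

NAFMinimal : (p q : ℤ) (w : ℕ) → Set
NAFMinimal p q w = ∀ ds → IsExpansion p q w ds → IsNAF w ds → IsOptimal p q w ds

-- ceiling division ⌈m / n⌉ (n > 0; returns 0 for n = 0)
cdiv : ℕ → ℕ → ℕ
cdiv m zero = 0
cdiv m (suc k) = (m ℕ.+ k) / suc k

aOf : ℕ → ℕ
aOf q = cdiv q 2

bOf : ℕ → ℕ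
bOf q = cdiv (q ℕ.* q) (6 ℕ.* q ℕ.∸ 2)

record Digits5 : Set where
  constructor digits
  field
    E A F B G : Zτ

digitsOdd : ℕ → Digits5
digitsOdd q = digits 𝟙
  (mk ((α - + 1) * Q - + 1) (Q - + 1))
  (mk (α - Q) (Q - α))
  (mk (+ 1 - α) (- α))
  (mk (+ 1 - α) (Q - α))
  where Q = + q ; α = + aOf q

digitsEven : ℕ → Digits5
digitsEven q = digits 𝟙
  (mk ((α - + 1) * Q + + 1) (α + β))
  (mk (- Q + β) (Q - α - + 1))
  (mk (- (α * Q) + + 1) (- α))
  (mk ((α - + 1) * Q + + 1) (α - + 1))
  where Q = + q ; α = + aOf q ; β = + bOf q

Claim : (p q : ℤ) → Digits5 → Set
Claim p q (digits E A F B G) =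
  (mul p q A (pow p q τ 2) ⊕ B
     ≡ (mul p q E (pow p q τ 6) ⊕ mul p q F (pow p q τ 3)) ⊕ G)
  × InDigitSet p q 3 A × InDigitSet p q 3 B × InDigitSet p q 3 E
  × InDigitSet p q 3 F × InDigitSet p q 3 G
  × IsExpansion p q 3 (B ∷ 𝟘 ∷ A ∷ [])
  × IsExpansion p q 3 (G ∷ 𝟘 ∷ 𝟘 ∷ F ∷ 𝟘 ∷ 𝟘 ∷ E ∷ [])
  × ¬ NAFMinimal p q 3

{-# OPTIONS --safe #-}
-- For p = -1 we have τ³ = q + (1 - q)τ and |τ³|² = q³.  A nonzero x + yτ is the minimal
-- norm representative of its class modulo τ³ iff τ ∤ x + yτ, i.e. q ∤ x, and
--   |x + yτ + τ³(c₀ + c₁τ)|² - |x + yτ|² = q³|c₀ + c₁τ|² + L₀c₀ + L₁c₁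
-- is positive for every (c₀, c₁) ≠ 0.  On each residue class of q modulo 2 (and modulo 6
-- for even q) the parameters a and b are linear in q, so writing q = q₀ + q₁s turns every
-- coordinate of the digit identity and every inequality needed for this positivity into an
-- integer polynomial in s ≥ 0; these are verified by expanding them and reading off the
-- signs of their coefficients.  The 3-NAF G00F00E of weight 3 then has the same value as
-- the expansion B0A of weight at most 2.
module Submission where

module Positivity where

  open import Data.Integer using (+_; -[1+_]; 0ℤ; _+_; _-_; _*_; _≤_; _<_; +≤+; +<+; nonNegative)
  open import Data.Integer.Properties
    using (+-mono-≤; +-mono-<-≤; +-identityˡ; +-monoˡ-<; pos-*; *-zeroʳ; <⇒≤; *-cancelˡ-<-nonNeg)
  open import Data.Integer.Tactic.RingSolver using (solve-∀)
  import Data.Nat as ℕ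
  open import Relation.Binary.PropositionalEquality using (_≡_; sym; subst; subst₂)

  0≤+ : ∀ n → 0ℤ ≤ + n
  0≤+ n = +≤+ ℕ.z≤n

  +-nonNeg : ∀ {i j} → 0ℤ ≤ i → 0ℤ ≤ j → 0ℤ ≤ i + j
  +-nonNeg = +-mono-≤ {0ℤ} {_} {0ℤ}

  +-pos : ∀ {i j} → 0ℤ < i → 0ℤ ≤ j → 0ℤ < i + j
  +-pos = +-mono-<-≤ {0ℤ} {_} {0ℤ}

  *-nonNeg : ∀ {i j} → 0ℤ ≤ i → 0ℤ ≤ j → 0ℤ ≤ i * j
  *-nonNeg {+ m} {+ n} _ _ = subst (0ℤ ≤_) (pos-* m n) (0≤+ (m ℕ.* n))

  *-pos : ∀ {i j} → 0ℤ < i → 0ℤ < j → 0ℤ < i * j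
  *-pos {+ ℕ.suc m} {+ ℕ.suc n} _ _ = subst (0ℤ <_) (pos-* (ℕ.suc m) (ℕ.suc n)) (+<+ (ℕ.s≤s ℕ.z≤n))
  *-pos {+ ℕ.zero}  (+<+ ()) _
  *-pos {+ ℕ.suc _} {+ ℕ.zero} _ (+<+ ())

  square-nonNeg : ∀ i → 0ℤ ≤ i * i
  square-nonNeg (+ n)    = *-nonNeg (0≤+ n) (0≤+ n)
  square-nonNeg -[1+ n ] = 0≤+ _

  pos-*-cancelˡ : ∀ {k i} → 0ℤ < k → 0ℤ < k * i → 0ℤ < i
  pos-*-cancelˡ {k} 0<k 0<ki =
    *-cancelˡ-<-nonNeg k {{nonNegative (<⇒≤ 0<k)}} (subst (_< k * _) (sym (*-zeroʳ k)) 0<ki)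

  0<i-j⇒j<i : ∀ {i j} → 0ℤ < i - j → j < i
  0<i-j⇒j<i {i} {j} 0<i-j = subst₂ _<_ (+-identityˡ j) (eq i j) (+-monoˡ-< j 0<i-j)
    where
    eq : ∀ i j → i - j + j ≡ i
    eq = solve-∀

module Polynomial where

  open Positivity using (0≤+; +-nonNeg; +-pos; *-nonNeg)
  open import Data.Bool using (Bool; true; false; T; _∧_)
  open import Data.Bool.Properties using (T-∧)
  open import Data.Integer using (ℤ; +_; 0ℤ; 1ℤ; -_; _+_; _*_; _≤_; _<_; _≤ᵇ_; _≟_)
  open import Data.Integer.Properties
    using (+-identityˡ; +-identityʳ; *-zeroʳ; pos-*; ≤ᵇ⇒≤; suc[i]≤j⇒i<j)
  open import Data.Integer.Tactic.RingSolver using (solve-∀)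
  open import Data.List using (List; []; _∷_; map)
  open import Data.Nat as ℕ using (ℕ)
  open import Data.Product using (_×_; proj₁; proj₂)
  open import Function.Bundles using (Equivalence)
  open import Relation.Nullary.Decidable using (isYes; toWitness)
  open import Relation.Binary.PropositionalEquality using (_≡_; refl; sym; trans; cong)

  Poly : Set
  Poly = List ℤ

  ev : Poly → ℤ → ℤ
  ev []       x = 0ℤ
  ev (c ∷ cs) x = c + x * ev cs x

  infixl 6 _+ₚ_
  infixl 7 _*ₚ_ _·ₚ_

  _+ₚ_ : Poly → Poly → Poly
  []       +ₚ ds       = ds
  (c ∷ cs) +ₚ []       = c ∷ cs
  (c ∷ cs) +ₚ (d ∷ ds) = c + d ∷ cs +ₚ ds

  _·ₚ_ : ℤ → Poly → Poly
  c ·ₚ ds = map (c *_) ds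

  _*ₚ_ : Poly → Poly → Poly
  []       *ₚ ds = []
  (c ∷ cs) *ₚ ds = c ·ₚ ds +ₚ (0ℤ ∷ cs *ₚ ds)

  -ₚ_ : Poly → Poly
  -ₚ_ = map -_

  linear : ℕ → ℕ → Poly
  linear c k = + c ∷ + k ∷ []

  ev-linear : ∀ c k s → ev (linear c k) (+ s) ≡ + (c ℕ.+ s ℕ.* k)
  ev-linear c k s =
    cong (λ t → + c + t)
         (trans (cong (+ s *_) (trans (cong (λ t → + k + t) (*-zeroʳ (+ s))) (+-identityʳ (+ k))))
                (sym (pos-* s k)))

  ev-+ : ∀ cs ds x → ev (cs +ₚ ds) x ≡ ev cs x + ev ds x
  ev-+ []       ds       x = sym (+-identityˡ _)
  ev-+ (c ∷ cs) []       x = sym (+-identityʳ _)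
  ev-+ (c ∷ cs) (d ∷ ds) x
    rewrite ev-+ cs ds x = shuffle c d x (ev cs x) (ev ds x)
    where
    shuffle : ∀ c d x u v → c + d + x * (u + v) ≡ c + x * u + (d + x * v)
    shuffle = solve-∀

  ev-· : ∀ c ds x → ev (c ·ₚ ds) x ≡ c * ev ds x
  ev-· c []       x = sym (*-zeroʳ c)
  ev-· c (d ∷ ds) x
    rewrite ev-· c ds x = distrib c d x (ev ds x)
    where
    distrib : ∀ c d x u → c * d + x * (c * u) ≡ c * (d + x * u)
    distrib = solve-∀

  ev-* : ∀ cs ds x → ev (cs *ₚ ds) x ≡ ev cs x * ev ds x
  ev-* []       ds x = refl
  ev-* (c ∷ cs) ds x
    rewrite ev-+ (c ·ₚ ds) (0ℤ ∷ cs *ₚ ds) x | ev-· c ds x | ev-* cs ds x =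
    distrib c x (ev cs x) (ev ds x)
    where
    distrib : ∀ c x u v → c * v + (0ℤ + x * (u * v)) ≡ (c + x * u) * v
    distrib = solve-∀

  ev-neg : ∀ cs x → ev (-ₚ cs) x ≡ - ev cs x
  ev-neg []       x = refl
  ev-neg (c ∷ cs) x
    rewrite ev-neg cs x = distrib c x (ev cs x)
    where
    distrib : ∀ c x u → - c + x * - u ≡ - (c + x * u)
    distrib = solve-∀

  zeroCoeffs : Poly → Bool
  zeroCoeffs []       = true
  zeroCoeffs (c ∷ cs) = isYes (c ≟ 0ℤ) ∧ zeroCoeffs cs

  nonNegCoeffs : Poly → Bool
  nonNegCoeffs []       = true
  nonNegCoeffs (c ∷ cs) = (0ℤ ≤ᵇ c) ∧ nonNegCoeffs cs

  posConstNonNegCoeffs : Poly → Bool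
  posConstNonNegCoeffs []       = false
  posConstNonNegCoeffs (c ∷ cs) = (1ℤ ≤ᵇ c) ∧ nonNegCoeffs cs

  T-∧⁻ : ∀ {a b} → T (a ∧ b) → T a × T b
  T-∧⁻ = Equivalence.to T-∧

  module _ {x : ℤ} (0≤x : 0ℤ ≤ x) where

    ev-nonNeg : ∀ cs → T (nonNegCoeffs cs) → 0ℤ ≤ ev cs x
    ev-nonNeg []       _ = 0≤+ 0
    ev-nonNeg (c ∷ cs) t =
      +-nonNeg {c} (≤ᵇ⇒≤ (proj₁ (T-∧⁻ t))) (*-nonNeg 0≤x (ev-nonNeg cs (proj₂ (T-∧⁻ t))))

    ev-pos : ∀ cs → T (posConstNonNegCoeffs cs) → 0ℤ < ev cs x
    ev-pos (c ∷ cs) t =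
      +-pos {c} (suc[i]≤j⇒i<j (≤ᵇ⇒≤ (proj₁ (T-∧⁻ t)))) (*-nonNeg 0≤x (ev-nonNeg cs (proj₂ (T-∧⁻ t))))

  ev-zero : ∀ cs x → T (zeroCoeffs cs) → ev cs x ≡ 0ℤ
  ev-zero []       x _ = refl
  ev-zero (c ∷ cs) x t
    rewrite toWitness {a? = c ≟ 0ℤ} (proj₁ (T-∧⁻ t)) | ev-zero cs x (proj₂ (T-∧⁻ t)) | *-zeroʳ x = refl

module Expression where

  open Positivity using (0≤+)
  open Polynomial
  open import Data.Bool using (Bool; true; T; _∧_)
  open import Data.Integer using (ℤ; +_; 0ℤ; -_; _+_; _-_; _*_; _≤_; _<_)
  open import Data.Integer.Properties using (+-identityʳ; *-zeroʳ)
  open import Data.List using (List; []; _∷_)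
  open import Data.List.Relation.Unary.All using (All; []; _∷_)
  open import Data.Nat using (ℕ)
  open import Data.Product using (proj₁; proj₂)
  open import Relation.Binary.PropositionalEquality using (_≡_; refl; sym; trans; cong; cong₂; subst)

  infixl 6 _:+_ _:-_
  infixl 7 _:*_
  infix  8 :-_

  data Expr : Set where
    :q :a :b       : Expr
    con            : ℤ → Expr
    _:+_ _:-_ _:*_ : Expr → Expr → Expr
    :-_            : Expr → Expr

  ⟦_⟧ : Expr → ℤ → ℤ → ℤ → ℤ
  ⟦ :q ⟧     q a b = q
  ⟦ :a ⟧     q a b = a
  ⟦ :b ⟧     q a b = b
  ⟦ con c ⟧  q a b = c
  ⟦ e :+ f ⟧ q a b = ⟦ e ⟧ q a b + ⟦ f ⟧ q a b
  ⟦ e :- f ⟧ q a b = ⟦ e ⟧ q a b - ⟦ f ⟧ q a b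
  ⟦ e :* f ⟧ q a b = ⟦ e ⟧ q a b * ⟦ f ⟧ q a b
  ⟦ :- e ⟧   q a b = - ⟦ e ⟧ q a b

  ⟦_⟧ₚ : Expr → Poly → Poly → Poly → Poly
  ⟦ :q ⟧ₚ     q a b = q
  ⟦ :a ⟧ₚ     q a b = a
  ⟦ :b ⟧ₚ     q a b = b
  ⟦ con c ⟧ₚ  q a b = c ∷ []
  ⟦ e :+ f ⟧ₚ q a b = ⟦ e ⟧ₚ q a b +ₚ ⟦ f ⟧ₚ q a b
  ⟦ e :- f ⟧ₚ q a b = ⟦ e ⟧ₚ q a b +ₚ -ₚ ⟦ f ⟧ₚ q a b
  ⟦ e :* f ⟧ₚ q a b = ⟦ e ⟧ₚ q a b *ₚ ⟦ f ⟧ₚ q a b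
  ⟦ :- e ⟧ₚ   q a b = -ₚ ⟦ e ⟧ₚ q a b

  module _ (q a b : Poly) (x : ℤ) where

    ⟦⟧-ev : ∀ e → ⟦ e ⟧ (ev q x) (ev a x) (ev b x) ≡ ev (⟦ e ⟧ₚ q a b) x
    ⟦⟧-ev :q       = refl
    ⟦⟧-ev :a       = refl
    ⟦⟧-ev :b       = refl
    ⟦⟧-ev (con c)  = sym (trans (cong (λ u → c + u) (*-zeroʳ x)) (+-identityʳ c))
    ⟦⟧-ev (e :+ f) = trans (cong₂ _+_ (⟦⟧-ev e) (⟦⟧-ev f)) (sym (ev-+ (⟦ e ⟧ₚ q a b) _ x))
    ⟦⟧-ev (e :- f) =
      trans (cong₂ _-_ (⟦⟧-ev e) (⟦⟧-ev f))
            (sym (trans (ev-+ (⟦ e ⟧ₚ q a b) _ x)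
                        (cong (λ u → ev (⟦ e ⟧ₚ q a b) x + u) (ev-neg (⟦ f ⟧ₚ q a b) x))))
    ⟦⟧-ev (e :* f) =
      trans (cong₂ _*_ (⟦⟧-ev e) (⟦⟧-ev f)) (sym (ev-* (⟦ e ⟧ₚ q a b) (⟦ f ⟧ₚ q a b) x))
    ⟦⟧-ev (:- e)   = trans (cong -_ (⟦⟧-ev e)) (sym (ev-neg (⟦ e ⟧ₚ q a b) x))

  data Constraint : Set where
    0<_ 0≤_ 0≡_ : Expr → Constraint

  Holds : ℤ → ℤ → ℤ → Constraint → Set
  Holds q a b (0< e) = 0ℤ < ⟦ e ⟧ q a b
  Holds q a b (0≤ e) = 0ℤ ≤ ⟦ e ⟧ q a b
  Holds q a b (0≡ e) = ⟦ e ⟧ q a b ≡ 0ℤ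

  -- Sufficient, by the signs of the coefficients, for the constraint to hold whenever
  -- q, a and b are the values of the given polynomials at some s ∈ ℕ.
  check : Poly → Poly → Poly → Constraint → Bool
  check q a b (0< e) = posConstNonNegCoeffs (⟦ e ⟧ₚ q a b)
  check q a b (0≤ e) = nonNegCoeffs (⟦ e ⟧ₚ q a b)
  check q a b (0≡ e) = zeroCoeffs (⟦ e ⟧ₚ q a b)

  checkAll : Poly → Poly → Poly → List Constraint → Bool
  checkAll q a b []       = true
  checkAll q a b (c ∷ cs) = check q a b c ∧ checkAll q a b cs

  module _ (q a b : Poly) (s : ℕ) where

    check-sound : ∀ c → T (check q a b c) → Holds (ev q (+ s)) (ev a (+ s)) (ev b (+ s)) c
    check-sound (0< e) t = subst (0ℤ <_) (sym (⟦⟧-ev q a b (+ s) e)) (ev-pos (0≤+ s) (⟦ e ⟧ₚ q a b) t)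
    check-sound (0≤ e) t = subst (0ℤ ≤_) (sym (⟦⟧-ev q a b (+ s) e)) (ev-nonNeg (0≤+ s) (⟦ e ⟧ₚ q a b) t)
    check-sound (0≡ e) t = trans (⟦⟧-ev q a b (+ s) e) (ev-zero (⟦ e ⟧ₚ q a b) (+ s) t)

    checkAll-sound : ∀ cs → T (checkAll q a b cs) → All (Holds (ev q (+ s)) (ev a (+ s)) (ev b (+ s))) cs
    checkAll-sound []       _ = []
    checkAll-sound (c ∷ cs) t = check-sound c (proj₁ (T-∧⁻ t)) ∷ checkAll-sound cs (proj₂ (T-∧⁻ t))

module BinaryForm where

  open Positivity
  open import Data.Empty using (⊥; ⊥-elim)
  open import Data.Integer using (ℤ; +_; -[1+_]; 0ℤ; -1ℤ; -_; _+_; _-_; _*_; _≤_; _<_; +<+)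
  open import Data.Integer.Properties using (+-mono-≤-<; <⇒≤)
  open import Data.Integer.Tactic.RingSolver using (solve-∀)
  open import Data.Nat using (zero; suc; s≤s; z≤n)
  open import Relation.Binary.PropositionalEquality using (_≡_; refl; sym; subst)

  quad : ℤ → ℤ → ℤ → ℤ → ℤ
  quad P R T x = P * x * x + R * x + T

  slope : ℤ → ℤ → ℤ → ℤ
  slope P R k = (k + k) * P + R

  record Rises (P R T k : ℤ) : Set where
    constructor rises
    field
      at-k     : 0ℤ < quad P R T k
      slope-≥0 : 0ℤ ≤ slope P R k

  record Falls (P R T k : ℤ) : Set where
    constructor falls
    field
      at-k     : 0ℤ < quad P R T k
      slope-≤0 : 0ℤ ≤ - slope P R k

  module _ {P R T : ℤ} (0≤P : 0ℤ ≤ P) where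

    quad-rises : ∀ {k} → Rises P R T k → ∀ n → 0ℤ < quad P R T (k + + n)
    quad-rises {k} (rises 0<q 0≤d) n =
      subst (0ℤ <_) (sym (shift P R T k (+ n))) (+-pos 0<q (*-nonNeg (0≤+ n) (+-nonNeg (*-nonNeg (0≤+ n) 0≤P) 0≤d)))
      where
      shift : ∀ P R T k m → P * (k + m) * (k + m) + R * (k + m) + T
                          ≡ (P * k * k + R * k + T) + m * (m * P + ((k + k) * P + R))
      shift = solve-∀

    quad-falls : ∀ {k} → Falls P R T k → ∀ n → 0ℤ < quad P R T (k - + n)
    quad-falls {k} (falls 0<q 0≤d) n =
      subst (0ℤ <_) (sym (shift P R T k (+ n))) (+-pos 0<q (*-nonNeg (0≤+ n) (+-nonNeg (*-nonNeg (0≤+ n) 0≤P) 0≤d)))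
      where
      shift : ∀ P R T k m → P * (k - m) * (k - m) + R * (k - m) + T
                          ≡ (P * k * k + R * k + T) + m * (m * P + - ((k + k) * P + R))
      shift = solve-∀

    quad-falls₋₁ : Falls P R T -1ℤ → ∀ n → 0ℤ < quad P R T -[1+ n ]
    quad-falls₋₁ f n = subst (λ c → 0ℤ < quad P R T c) (-1-n≡-[1+n] n) (quad-falls f n)
      where
      -1-n≡-[1+n] : ∀ n → -1ℤ - + n ≡ -[1+ n ]
      -1-n≡-[1+n] zero    = refl
      -1-n≡-[1+n] (suc n) = refl

    quad-falls₋₂ : Falls P R T (- (+ 2)) → ∀ n → 0ℤ < quad P R T -[1+ suc n ]
    quad-falls₋₂ f n = subst (λ c → 0ℤ < quad P R T c) (-2-n≡-[2+n] n) (quad-falls f n)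
      where
      -2-n≡-[2+n] : ∀ n → - (+ 2) - + n ≡ -[1+ suc n ]
      -2-n≡-[2+n] zero    = refl
      -2-n≡-[2+n] (suc n) = refl

  form : ℤ → ℤ → ℤ → ℤ → ℤ → ℤ → ℤ
  form M K L₀ L₁ c₀ c₁ = M * c₀ * c₀ - M * c₀ * c₁ + K * c₁ * c₁ + L₀ * c₀ + L₁ * c₁

  disc : ℤ → ℤ → ℤ
  disc M K = + 4 * M * K - M * M

  cross : ℤ → ℤ → ℤ → ℤ
  cross M L₀ L₁ = + 4 * M * L₁ + + 2 * M * L₀

  -- On each row c₁ ∈ {0, 1, -1} the form is a quadratic in c₀, positive at two adjacent
  -- integers (±1 on the row c₁ = 0) and monotone outward from them.  For |c₁| ≥ 2, completing
  -- the square gives 4M · form ≥ quad (disc M K) (cross M L₀ L₁) (-L₀²) c₁, positive at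
  -- c₁ = ±2 and monotone outward.
  record FormConditions (M K L₀ L₁ : ℤ) : Set where
    field
      M-pos       : 0ℤ < M
      row₀⁺       : Rises M L₀ 0ℤ (+ 1)
      row₀⁻       : Falls M L₀ 0ℤ -1ℤ
      row₁⁺       : Rises M (L₀ - M) (K + L₁) (+ 1)
      row₁⁻       : Falls M (L₀ - M) (K + L₁) 0ℤ
      row₋₁⁺      : Rises M (L₀ + M) (K - L₁) 0ℤ
      row₋₁⁻      : Falls M (L₀ + M) (K - L₁) -1ℤ
      disc-nonNeg : 0ℤ ≤ disc M K
      outer⁺      : Rises (disc M K) (cross M L₀ L₁) (- (L₀ * L₀)) (+ 2)
      outer⁻      : Falls (disc M K) (cross M L₀ L₁) (- (L₀ * L₀)) (- (+ 2))

  form-pos : ∀ {M K L₀ L₁} → FormConditions M K L₀ L₁ →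
             ∀ c₀ c₁ → (c₀ ≡ 0ℤ → c₁ ≡ 0ℤ → ⊥) → 0ℤ < form M K L₀ L₁ c₀ c₁
  form-pos {M} {K} {L₀} {L₁} conds = pos
    where
    open FormConditions conds
    0≤M = <⇒≤ M-pos

    row₀ : ∀ c₀ → 0ℤ < quad M L₀ 0ℤ c₀ → 0ℤ < form M K L₀ L₁ c₀ 0ℤ
    row₀ c₀ = subst (0ℤ <_) (eq M K L₀ L₁ c₀)
      where
      eq : ∀ M K L₀ L₁ c₀ → M * c₀ * c₀ + L₀ * c₀ + + 0
                          ≡ M * c₀ * c₀ - M * c₀ * + 0 + K * + 0 * + 0 + L₀ * c₀ + L₁ * + 0
      eq = solve-∀

    row₁ : ∀ c₀ → 0ℤ < quad M (L₀ - M) (K + L₁) c₀ → 0ℤ < form M K L₀ L₁ c₀ (+ 1)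
    row₁ c₀ = subst (0ℤ <_) (eq M K L₀ L₁ c₀)
      where
      eq : ∀ M K L₀ L₁ c₀ → M * c₀ * c₀ + (L₀ - M) * c₀ + (K + L₁)
                          ≡ M * c₀ * c₀ - M * c₀ * + 1 + K * + 1 * + 1 + L₀ * c₀ + L₁ * + 1
      eq = solve-∀

    row₋₁ : ∀ c₀ → 0ℤ < quad M (L₀ + M) (K - L₁) c₀ → 0ℤ < form M K L₀ L₁ c₀ -1ℤ
    row₋₁ c₀ = subst (0ℤ <_) (eq M K L₀ L₁ c₀)
      where
      eq : ∀ M K L₀ L₁ c₀ → M * c₀ * c₀ + (L₀ + M) * c₀ + (K - L₁)
                          ≡ M * c₀ * c₀ - M * c₀ * - (+ 1) + K * - (+ 1) * - (+ 1) + L₀ * c₀ + L₁ * - (+ 1)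
      eq = solve-∀

    outer : ∀ c₀ c₁ → 0ℤ < quad (disc M K) (cross M L₀ L₁) (- (L₀ * L₀)) c₁ →
            0ℤ < form M K L₀ L₁ c₀ c₁
    outer c₀ c₁ 0<g = pos-*-cancelˡ (*-pos {+ 4} (+<+ (s≤s z≤n)) M-pos)
      (subst (0ℤ <_) (sym (square M K L₀ L₁ c₀ c₁))
        (+-mono-≤-< {0ℤ} {_} {0ℤ} (square-nonNeg (+ 2 * M * c₀ - M * c₁ + L₀)) 0<g))
      where
      square : ∀ M K L₀ L₁ c₀ c₁ →
        + 4 * M * (M * c₀ * c₀ - M * c₀ * c₁ + K * c₁ * c₁ + L₀ * c₀ + L₁ * c₁)
          ≡ (+ 2 * M * c₀ - M * c₁ + L₀) * (+ 2 * M * c₀ - M * c₁ + L₀)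
            + ((+ 4 * M * K - M * M) * c₁ * c₁ + (+ 4 * M * L₁ + + 2 * M * L₀) * c₁ + - (L₀ * L₀))
      square = solve-∀

    pos : ∀ c₀ c₁ → (c₀ ≡ 0ℤ → c₁ ≡ 0ℤ → ⊥) → 0ℤ < form M K L₀ L₁ c₀ c₁
    pos (+ zero)  (+ zero) c≢0 = ⊥-elim (c≢0 refl refl)
    pos (+ suc n) (+ zero) _   = row₀ _ (quad-rises 0≤M row₀⁺ n)
    pos -[1+ n ]  (+ zero) _   = row₀ _ (quad-falls₋₁ 0≤M row₀⁻ n)
    pos (+ suc n) (+ 1)    _   = row₁ _ (quad-rises 0≤M row₁⁺ n)
    pos (+ zero)  (+ 1)    _   = row₁ _ (quad-falls 0≤M row₁⁻ 0)
    pos -[1+ n ]  (+ 1)    _   = row₁ _ (quad-falls 0≤M row₁⁻ (suc n))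
    pos (+ n)     -[1+ 0 ] _   = row₋₁ _ (quad-rises 0≤M row₋₁⁺ n)
    pos -[1+ n ]  -[1+ 0 ] _   = row₋₁ _ (quad-falls₋₁ 0≤M row₋₁⁻ n)
    pos c₀ (+ suc (suc n)) _   = outer c₀ _ (quad-rises disc-nonNeg outer⁺ n)
    pos c₀ -[1+ suc n ]    _   = outer c₀ _ (quad-falls₋₂ disc-nonNeg outer⁻ n)

module DigitSet where

  open import Defs
  open Positivity using (pos-*-cancelˡ)
  open BinaryForm using (form; FormConditions; form-pos)
  open import Data.Empty using (⊥)
  open import Data.Integer using (ℤ; +_; 0ℤ; 1ℤ; -1ℤ; -_; _+_; _-_; _*_; _<_; nonNegative)
  open import Data.Integer.Properties
    using (*-zeroʳ; *-identityʳ; +-identityʳ; +-monoʳ-<; *-cancelˡ-<-nonNeg; <⇒≤; <-trans; ≤-<-trans;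
           <-irrefl; i<j⇒suc[i]≤j)
  open import Data.Integer.Tactic.RingSolver using (solve-∀)
  open import Data.Product using (_,_)
  open import Function using (_∘_)
  open import Relation.Binary.PropositionalEquality
  open import Relation.Nullary using (¬_)

  τ-mul : ∀ p q a b {a′ b′} → - (q * b) ≡ a′ → a + p * b ≡ b′ → mul p q τ (mk a b) ≡ mk a′ b′
  τ-mul p q a b refl refl = cong₂ mk (re-eq p q a b) (im-eq p q a b)
    where
    re-eq : ∀ p q a b → + 0 * a - q * (+ 1 * b) ≡ - (q * b)
    re-eq = solve-∀
    im-eq : ∀ p q a b → + 0 * b + + 1 * a + p * (+ 1 * b) ≡ a + p * b
    im-eq = solve-∀

  τ³ : ∀ Q → pow -1ℤ Q τ 3 ≡ mk Q (+ 1 - Q)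
  τ³ Q = begin
    mul -1ℤ Q τ (mul -1ℤ Q τ (mul -1ℤ Q τ 𝟙))
      ≡⟨ cong (mul -1ℤ Q τ ∘ mul -1ℤ Q τ) (τ-mul -1ℤ Q (+ 1) (+ 0) (cong -_ (*-zeroʳ Q)) refl) ⟩
    mul -1ℤ Q τ (mul -1ℤ Q τ τ)
      ≡⟨ cong (mul -1ℤ Q τ) (τ-mul -1ℤ Q (+ 0) (+ 1) (cong -_ (*-identityʳ Q)) refl) ⟩
    mul -1ℤ Q τ (mk (- Q) -1ℤ)
      ≡⟨ τ-mul -1ℤ Q (- Q) -1ℤ (re-eq Q) (im-eq Q) ⟩
    mk Q (+ 1 - Q) ∎
    where
    open ≡-Reasoning
    re-eq : ∀ Q → - (Q * - (+ 1)) ≡ Q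
    re-eq = solve-∀
    im-eq : ∀ Q → - Q + - (+ 1) * - (+ 1) ≡ + 1 - Q
    im-eq = solve-∀

  mul-zeroʳ : ∀ p q w → mul p q w 𝟘 ≡ 𝟘
  mul-zeroʳ p q (mk a b) = cong₂ mk (re-eq p q a b) (im-eq p q a b)
    where
    re-eq : ∀ p q a b → a * + 0 - q * (b * + 0) ≡ + 0
    re-eq = solve-∀
    im-eq : ∀ p q a b → a * + 0 + b * + 0 + p * (b * + 0) ≡ + 0
    im-eq = solve-∀

  ⊕-identityʳ : ∀ z → z ⊕ 𝟘 ≡ z
  ⊕-identityʳ (mk a b) = cong₂ mk (+-identityʳ a) (+-identityʳ b)

  ⊖≡⇒≡⊕ : ∀ {z d w} → z ⊖ d ≡ w → z ≡ d ⊕ w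
  ⊖≡⇒≡⊕ {mk a b} {mk c e} refl = cong₂ mk (eq a c) (eq b e)
    where
    eq : ∀ a c → a ≡ c + (a - c)
    eq = solve-∀

  ¬0<q*w<q : ∀ {q w} → 0ℤ < q → 0ℤ < q * w → q * w < q → ⊥
  ¬0<q*w<q {q} {w} 0<q 0<qw qw<q = <-irrefl refl (≤-<-trans (i<j⇒suc[i]≤j 0<w) w<1)
    where
    0<w : 0ℤ < w
    0<w = pos-*-cancelˡ 0<q 0<qw
    w<1 : w < 1ℤ
    w<1 = *-cancelˡ-<-nonNeg q {{nonNegative (<⇒≤ 0<q)}} (subst (q * w <_) (sym (*-identityʳ q)) qw<q)

  τ∤ : ∀ p q {x} u r → x ≡ q * u + r → 0ℤ < r → r < q → ∀ y → ¬ Divides p q τ (mk x y)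
  τ∤ p q {x} u r x≡qu+r 0<r r<q y (mk c₀ c₁ , x+yτ≡τc) =
    ¬0<q*w<q (<-trans 0<r r<q) (subst (0ℤ <_) r≡qw 0<r) (subst (_< q) r≡qw r<q)
    where
    x≡-qc₁ : x ≡ - (q * c₁)
    x≡-qc₁ = trans (cong re x+yτ≡τc) (re-eq q c₀ c₁)
      where
      re-eq : ∀ q c₀ c₁ → + 0 * c₀ - q * (+ 1 * c₁) ≡ - (q * c₁)
      re-eq = solve-∀
    r≡qw : r ≡ q * (- c₁ - u)
    r≡qw = begin
      r                   ≡⟨ eq₁ q u r ⟩
      (q * u + r) - q * u ≡⟨ cong (_- q * u) (trans (sym x≡qu+r) x≡-qc₁) ⟩
      - (q * c₁) - q * u  ≡⟨ eq₂ q u c₁ ⟩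
      q * (- c₁ - u)      ∎
      where
      open ≡-Reasoning
      eq₁ : ∀ q u r → r ≡ (q * u + r) - q * u
      eq₁ = solve-∀
      eq₂ : ∀ q u c₁ → - (q * c₁) - q * u ≡ q * (- c₁ - u)
      eq₂ = solve-∀

  τ∤⇒≢𝟘 : ∀ p q {d} → ¬ Divides p q τ d → d ≢ 𝟘
  τ∤⇒≢𝟘 p q τ∤d refl = τ∤d (𝟘 , sym (mul-zeroʳ p q τ))

  -- L₀ c₀ + L₁ c₁ is twice the inner product, for the norm form, of x + yτ and τ³(c₀ + c₁τ).
  L₀ L₁ : ℤ → ℤ → ℤ → ℤ
  L₀ Q x y = (+ 3 * Q - + 1) * x + (Q - + 2 * Q * Q) * y
  L₁ Q x y = (+ 2 * Q * Q - + 4 * Q + + 1) * x + (+ 3 * Q * Q - Q) * y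

  norm-τ³-shift : ∀ Q x y c₀ c₁ →
    norm -1ℤ Q (mk x y ⊕ mul -1ℤ Q (mk Q (+ 1 - Q)) (mk c₀ c₁))
      ≡ norm -1ℤ Q (mk x y) + form (Q * Q * Q) (Q * (Q * Q * Q)) (L₀ Q x y) (L₁ Q x y) c₀ c₁
  norm-τ³-shift = expand
    where
    expand : ∀ Q x y c₀ c₁ →
      let u = Q * c₀ - Q * ((+ 1 - Q) * c₁)
          v = Q * c₁ + (+ 1 - Q) * c₀ + - (+ 1) * ((+ 1 - Q) * c₁)
      in (x + u) * (x + u) + - (+ 1) * ((x + u) * (y + v)) + Q * ((y + v) * (y + v))
           ≡ (x * x + - (+ 1) * (x * y) + Q * (y * y))
             + (Q * Q * Q * c₀ * c₀ - Q * Q * Q * c₀ * c₁ + Q * (Q * Q * Q) * c₁ * c₁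
                + ((+ 3 * Q - + 1) * x + (Q - + 2 * Q * Q) * y) * c₀
                + ((+ 2 * Q * Q - + 4 * Q + + 1) * x + (+ 3 * Q * Q - Q) * y) * c₁)
    expand = solve-∀

  minimal-in-τ³-class : ∀ Q x y → FormConditions (Q * Q * Q) (Q * (Q * Q * Q)) (L₀ Q x y) (L₁ Q x y) →
    ∀ z → Divides -1ℤ Q (pow -1ℤ Q τ 3) (z ⊖ mk x y) → z ≢ mk x y → norm -1ℤ Q (mk x y) < norm -1ℤ Q z
  minimal-in-τ³-class Q x y conds z (mk c₀ c₁ , z-d≡τ³c) z≢d =
    subst (norm -1ℤ Q (mk x y) <_)
          (trans (sym (norm-τ³-shift Q x y c₀ c₁)) (cong (norm -1ℤ Q) (sym z≡d+τ³c)))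
          (n<n+f (form-pos conds c₀ c₁ c≢0))
    where
    z≡d+τ³c : z ≡ mk x y ⊕ mul -1ℤ Q (mk Q (+ 1 - Q)) (mk c₀ c₁)
    z≡d+τ³c = ⊖≡⇒≡⊕ (trans z-d≡τ³c (cong (λ t → mul -1ℤ Q t (mk c₀ c₁)) (τ³ Q)))
    c≢0 : c₀ ≡ 0ℤ → c₁ ≡ 0ℤ → ⊥
    c≢0 refl refl =
      z≢d (trans z≡d+τ³c (trans (cong (mk x y ⊕_) (mul-zeroʳ -1ℤ Q (mk Q (+ 1 - Q)))) (⊕-identityʳ (mk x y))))
    n<n+f : ∀ {n f} → 0ℤ < f → n < n + f
    n<n+f {n} 0<f = subst (_< n + _) (+-identityʳ n) (+-monoʳ-< n 0<f)

module Expansion where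

  open import Defs
  open import Data.Integer using (+_; -[1+_])
  open import Data.List using (List; []; _∷_)
  open import Data.List.Relation.Unary.All using ([]; _∷_)
  open import Data.Nat using (zero; suc; _+_; _<_; _≤_; s≤s)
  open import Data.Nat.Properties using (≤-refl; n≤1+n; ≤-trans; <⇒≱)
  open import Data.Product using (_×_; _,_; proj₁; proj₂)
  open import Data.Sum using (_⊎_; inj₁; inj₂; map)
  open import Function using (id)
  open import Relation.Binary.PropositionalEquality using (_≡_; _≢_; refl; sym; cong; subst)
  open import Relation.Nullary using (¬_)

  weight-∷ : ∀ d ds → weight (d ∷ ds) ≤ suc (weight ds)
  weight-∷ (mk (+ zero)  (+ zero))  ds = n≤1+n _
  weight-∷ (mk (+ zero)  (+ suc _)) ds = ≤-refl
  weight-∷ (mk (+ zero)  -[1+ _ ])  ds = ≤-refl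
  weight-∷ (mk (+ suc _) _)         ds = ≤-refl
  weight-∷ (mk -[1+ _ ]  _)         ds = ≤-refl

  weight-∷-≢𝟘 : ∀ {d} ds → d ≢ 𝟘 → weight (d ∷ ds) ≡ suc (weight ds)
  weight-∷-≢𝟘 {mk (+ zero)  (+ zero)}  ds d≢𝟘 with () ← d≢𝟘 refl
  weight-∷-≢𝟘 {mk (+ zero)  (+ suc _)} ds _ = refl
  weight-∷-≢𝟘 {mk (+ zero)  -[1+ _ ]}  ds _ = refl
  weight-∷-≢𝟘 {mk (+ suc _) _}         ds _ = refl
  weight-∷-≢𝟘 {mk -[1+ _ ]  _}         ds _ = refl

  ¬NAFMinimal : ∀ {p q w} ds es → IsExpansion p q w ds → IsNAF w ds → IsExpansion p q w es →
                value p q es ≡ value p q ds → weight es < weight ds → ¬ NAFMinimal p q w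
  ¬NAFMinimal ds es ds-exp ds-naf es-exp same-value lighter minimal =
    <⇒≱ lighter (minimal ds ds-exp ds-naf es es-exp same-value)

  spaced : Zτ → Zτ → Zτ → List Zτ
  spaced G F E = G ∷ 𝟘 ∷ 𝟘 ∷ F ∷ 𝟘 ∷ 𝟘 ∷ E ∷ []

  spaced-gap : ∀ G F E i → digitAt (spaced G F E) i ≡ 𝟘
                          ⊎ (digitAt (spaced G F E) (suc i) ≡ 𝟘 × digitAt (spaced G F E) (suc (suc i)) ≡ 𝟘)
  spaced-gap G F E 0 = inj₂ (refl , refl)
  spaced-gap G F E 1 = inj₁ refl
  spaced-gap G F E 2 = inj₁ refl
  spaced-gap G F E 3 = inj₂ (refl , refl)
  spaced-gap G F E 4 = inj₁ refl
  spaced-gap G F E 5 = inj₁ refl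
  spaced-gap G F E 6 = inj₂ (refl , refl)
  spaced-gap G F E (suc (suc (suc (suc (suc (suc (suc _))))))) = inj₁ refl

  next-two : ∀ {i j} → i < j → j < i + 3 → j ≡ suc i ⊎ j ≡ suc (suc i)
  next-two {zero}  {suc zero}          _ _ = inj₁ refl
  next-two {zero}  {suc (suc zero)}    _ _ = inj₂ refl
  next-two {zero}  {suc (suc (suc _))} _ (s≤s (s≤s (s≤s ())))
  next-two {suc i} {suc j} (s≤s i<j) (s≤s j<i+3) = map (cong suc) (cong suc) (next-two i<j j<i+3)

  spaced-isNAF : ∀ G F E → IsNAF 3 (spaced G F E)
  spaced-isNAF G F E i j i<j j<i+3 with next-two i<j j<i+3
  ... | inj₁ refl = map id proj₁ (spaced-gap G F E i)
  ... | inj₂ refl = map id proj₂ (spaced-gap G F E i)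

  weight-spaced : ∀ {G F E} → G ≢ 𝟘 → F ≢ 𝟘 → E ≢ 𝟘 → weight (spaced G F E) ≡ 3
  weight-spaced {G} {F} {E} G≢𝟘 F≢𝟘 E≢𝟘
    rewrite weight-∷-≢𝟘 (𝟘 ∷ 𝟘 ∷ F ∷ 𝟘 ∷ 𝟘 ∷ E ∷ []) G≢𝟘
          | weight-∷-≢𝟘 (𝟘 ∷ 𝟘 ∷ E ∷ []) F≢𝟘
          | weight-∷-≢𝟘 [] E≢𝟘 = refl

  weight-B0A : ∀ B A → weight (B ∷ 𝟘 ∷ A ∷ []) ≤ 2
  weight-B0A B A = ≤-trans (weight-∷ B (𝟘 ∷ A ∷ [])) (s≤s (weight-∷ A []))

  claim-intro : ∀ {p q E A F B G} →
    mul p q A (pow p q τ 2) ⊕ B ≡ (mul p q E (pow p q τ 6) ⊕ mul p q F (pow p q τ 3)) ⊕ G →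
    value p q (B ∷ 𝟘 ∷ A ∷ []) ≡ value p q (spaced G F E) →
    InDigitSet p q 3 A → InDigitSet p q 3 B → InDigitSet p q 3 E → InDigitSet p q 3 F → InDigitSet p q 3 G →
    E ≢ 𝟘 → F ≢ 𝟘 → G ≢ 𝟘 → Claim p q (digits E A F B G)
  claim-intro {p} {q} {E} {A} {F} {B} {G} identity same-value A∈D B∈D E∈D F∈D G∈D E≢𝟘 F≢𝟘 G≢𝟘 =
    identity , A∈D , B∈D , E∈D , F∈D , G∈D , B0A , G00F00E ,
    ¬NAFMinimal (spaced G F E) (B ∷ 𝟘 ∷ A ∷ []) G00F00E (spaced-isNAF G F E) B0A same-value
      (subst (weight (B ∷ 𝟘 ∷ A ∷ []) <_) (sym (weight-spaced G≢𝟘 F≢𝟘 E≢𝟘)) (s≤s (weight-B0A B A)))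
    where
    0∈D : InDigitSet p q 3 𝟘
    0∈D = inj₁ refl
    B0A     = B∈D ∷ 0∈D ∷ A∈D ∷ []
    G00F00E = G∈D ∷ 0∈D ∷ 0∈D ∷ F∈D ∷ 0∈D ∷ 0∈D ∷ E∈D ∷ []

module Certification where

  open import Defs
  open Positivity using (0<i-j⇒j<i)
  open Polynomial using (Poly; ev; linear)
  open Expression
  open BinaryForm using (FormConditions; rises; falls)
  open DigitSet using (τ∤; τ∤⇒≢𝟘; L₀; L₁; minimal-in-τ³-class)
  open Expansion using (spaced; claim-intro)
  open import Data.Bool using (T)
  open import Data.Integer using (ℤ; +_; 0ℤ; -1ℤ; -_)
  open import Data.Integer.Properties using (i-j≡0⇒i≡j)
  open import Data.List using (List; []; _∷_; _++_; map)
  open import Data.List.Relation.Unary.All using (All; []; _∷_)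
  open import Data.Nat using (ℕ; zero; suc)
  open import Data.Product using (_×_; _,_; proj₁; proj₂)
  open import Data.Sum using (inj₂)
  open import Relation.Binary.PropositionalEquality

  record Zτᴱ : Set where
    constructor mkᴱ
    field
      reᴱ imᴱ : Expr

  ⟦_⟧ᶻ : Zτᴱ → ℤ → ℤ → ℤ → Zτ
  ⟦ mkᴱ x y ⟧ᶻ q a b = mk (⟦ x ⟧ q a b) (⟦ y ⟧ q a b)

  𝟘ᴱ 𝟙ᴱ τᴱ : Zτᴱ
  𝟘ᴱ = mkᴱ (con (+ 0)) (con (+ 0))
  𝟙ᴱ = mkᴱ (con (+ 1)) (con (+ 0))
  τᴱ = mkᴱ (con (+ 0)) (con (+ 1))

  -- Transcriptions of _⊕_, mul, pow and value at p = -1: as Zτᴱ has η, ⟦_⟧ᶻ commutes with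
  -- _⊕ᴱ_ and mulᴱ definitionally.
  infixl 6 _⊕ᴱ_

  _⊕ᴱ_ : Zτᴱ → Zτᴱ → Zτᴱ
  mkᴱ a b ⊕ᴱ mkᴱ c d = mkᴱ (a :+ c) (b :+ d)

  mulᴱ : Zτᴱ → Zτᴱ → Zτᴱ
  mulᴱ (mkᴱ a b) (mkᴱ c d) = mkᴱ (a :* c :- :q :* (b :* d)) (a :* d :+ b :* c :+ con -1ℤ :* (b :* d))

  powᴱ : Zτᴱ → ℕ → Zτᴱ
  powᴱ z zero    = 𝟙ᴱ
  powᴱ z (suc n) = mulᴱ z (powᴱ z n)

  valueᴱ : List Zτᴱ → Zτᴱ
  valueᴱ []       = 𝟘ᴱ
  valueᴱ (d ∷ ds) = d ⊕ᴱ mulᴱ τᴱ (valueᴱ ds)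

  module _ (q a b : ℤ) where

    ⟦⟧-pow : ∀ z n → ⟦ powᴱ z n ⟧ᶻ q a b ≡ pow -1ℤ q (⟦ z ⟧ᶻ q a b) n
    ⟦⟧-pow z zero    = refl
    ⟦⟧-pow z (suc n) = cong (mul -1ℤ q (⟦ z ⟧ᶻ q a b)) (⟦⟧-pow z n)

    ⟦⟧-value : ∀ ds → ⟦ valueᴱ ds ⟧ᶻ q a b ≡ value -1ℤ q (map (λ d → ⟦ d ⟧ᶻ q a b) ds)
    ⟦⟧-value []       = refl
    ⟦⟧-value (d ∷ ds) = cong (λ v → ⟦ d ⟧ᶻ q a b ⊕ mul -1ℤ q τ v) (⟦⟧-value ds)

  infix 4 _≐_

  _≐_ : Zτᴱ → Zτᴱ → List Constraint
  mkᴱ a b ≐ mkᴱ c d = 0≡ (a :- c) ∷ 0≡ (b :- d) ∷ []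

  ≐-sound : ∀ {q a b} z w → All (Holds q a b) (z ≐ w) → ⟦ z ⟧ᶻ q a b ≡ ⟦ w ⟧ᶻ q a b
  ≐-sound (mkᴱ _ _) (mkᴱ _ _) (re≡ ∷ im≡ ∷ []) = cong₂ mk (i-j≡0⇒i≡j _ _ re≡) (i-j≡0⇒i≡j _ _ im≡)

  quadᴱ : Expr → Expr → Expr → Expr → Expr
  quadᴱ P R T x = P :* x :* x :+ R :* x :+ T

  slopeᴱ : Expr → Expr → Expr → Expr
  slopeᴱ P R k = (k :+ k) :* P :+ R

  risesᴱ fallsᴱ : Expr → Expr → Expr → Expr → List Constraint
  risesᴱ P R T k = 0< quadᴱ P R T k ∷ 0≤ slopeᴱ P R k ∷ []
  fallsᴱ P R T k = 0< quadᴱ P R T k ∷ 0≤ (:- slopeᴱ P R k) ∷ []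

  discᴱ : Expr → Expr → Expr
  discᴱ M K = con (+ 4) :* M :* K :- M :* M

  crossᴱ : Expr → Expr → Expr → Expr
  crossᴱ M L₀ L₁ = con (+ 4) :* M :* L₁ :+ con (+ 2) :* M :* L₀

  formConditionsᴱ : Expr → Expr → Expr → Expr → List Constraint
  formConditionsᴱ M K L₀ L₁ =
    0< M ∷
    risesᴱ M L₀ (con 0ℤ) (con (+ 1)) ++ fallsᴱ M L₀ (con 0ℤ) (con -1ℤ) ++
    risesᴱ M (L₀ :- M) (K :+ L₁) (con (+ 1)) ++ fallsᴱ M (L₀ :- M) (K :+ L₁) (con 0ℤ) ++
    risesᴱ M (L₀ :+ M) (K :- L₁) (con 0ℤ) ++ fallsᴱ M (L₀ :+ M) (K :- L₁) (con -1ℤ) ++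
    0≤ discᴱ M K ∷
    risesᴱ (discᴱ M K) (crossᴱ M L₀ L₁) (:- (L₀ :* L₀)) (con (+ 2)) ++
    fallsᴱ (discᴱ M K) (crossᴱ M L₀ L₁) (:- (L₀ :* L₀)) (con (- (+ 2)))

  formConditions-sound : ∀ {q a b} M K L₀ L₁ → All (Holds q a b) (formConditionsᴱ M K L₀ L₁) →
    FormConditions (⟦ M ⟧ q a b) (⟦ K ⟧ q a b) (⟦ L₀ ⟧ q a b) (⟦ L₁ ⟧ q a b)
  formConditions-sound M K L₀ L₁
    (M-pos ∷ r₀⁺ ∷ s₀⁺ ∷ r₀⁻ ∷ s₀⁻ ∷ r₁⁺ ∷ s₁⁺ ∷ r₁⁻ ∷ s₁⁻ ∷ r₋₁⁺ ∷ s₋₁⁺ ∷ r₋₁⁻ ∷ s₋₁⁻ ∷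
     disc≥0 ∷ r⁺ ∷ s⁺ ∷ r⁻ ∷ s⁻ ∷ []) = record
    { M-pos       = M-pos
    ; row₀⁺       = rises r₀⁺ s₀⁺
    ; row₀⁻       = falls r₀⁻ s₀⁻
    ; row₁⁺       = rises r₁⁺ s₁⁺
    ; row₁⁻       = falls r₁⁻ s₁⁻
    ; row₋₁⁺      = rises r₋₁⁺ s₋₁⁺
    ; row₋₁⁻      = falls r₋₁⁻ s₋₁⁻
    ; disc-nonNeg = disc≥0
    ; outer⁺      = rises r⁺ s⁺
    ; outer⁻      = falls r⁻ s⁻
    }

  L₀ᴱ L₁ᴱ : Expr → Expr → Expr
  L₀ᴱ x y = (con (+ 3) :* :q :- con (+ 1)) :* x :+ (:q :- con (+ 2) :* :q :* :q) :* y
  L₁ᴱ x y = (con (+ 2) :* :q :* :q :- con (+ 4) :* :q :+ con (+ 1)) :* x :+ (con (+ 3) :* :q :* :q :- :q) :* y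

  -- quot and rem exhibit re digit = q · quot + rem with 0 < rem < q, so that τ ∤ digit.
  record DigitCertificate : Set where
    constructor certificate
    field
      digit    : Zτᴱ
      quot rem : Expr

  open DigitCertificate using (digit)

  digitConditionsᴱ : DigitCertificate → List Constraint
  digitConditionsᴱ (certificate (mkᴱ x y) u r) =
    0≡ (x :- (:q :* u :+ r)) ∷ 0< r ∷ 0< (:q :- r) ∷
    formConditionsᴱ (:q :* :q :* :q) (:q :* (:q :* :q :* :q)) (L₀ᴱ x y) (L₁ᴱ x y)

  digitConditions-sound : ∀ {q a b} c → All (Holds q a b) (digitConditionsᴱ c) →
    InDigitSet -1ℤ q 3 (⟦ digit c ⟧ᶻ q a b) × ⟦ digit c ⟧ᶻ q a b ≢ 𝟘
  digitConditions-sound {q} {a} {b} (certificate (mkᴱ x y) u r) (x≡qu+r ∷ 0<r ∷ 0<q-r ∷ conds) =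
    inj₂ (τ∤x+yτ , minimal-in-τ³-class q x′ y′ (formConditions-sound _ _ (L₀ᴱ x y) (L₁ᴱ x y) conds)) ,
    τ∤⇒≢𝟘 -1ℤ q τ∤x+yτ
    where
    x′ = ⟦ x ⟧ q a b
    y′ = ⟦ y ⟧ q a b
    τ∤x+yτ = τ∤ -1ℤ q (⟦ u ⟧ q a b) (⟦ r ⟧ q a b) (i-j≡0⇒i≡j _ _ x≡qu+r) 0<r (0<i-j⇒j<i 0<q-r) y′

  𝟙-certificate : DigitCertificate
  𝟙-certificate = certificate 𝟙ᴱ (con (+ 0)) (con (+ 1))

  -- q, a and b as polynomials in s, with the digits A, F, B, G in terms of them.
  record Family : Set where
    field
      q a b   : Poly
      A F B G : DigitCertificate

  module _ (fam : Family) where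

    open Family fam

    lhsᴱ rhsᴱ : Zτᴱ
    lhsᴱ = mulᴱ (digit A) (powᴱ τᴱ 2) ⊕ᴱ digit B
    rhsᴱ = (mulᴱ 𝟙ᴱ (powᴱ τᴱ 6) ⊕ᴱ mulᴱ (digit F) (powᴱ τᴱ 3)) ⊕ᴱ digit G

    B0Aᴱ G00F00Eᴱ : List Zτᴱ
    B0Aᴱ     = digit B ∷ 𝟘ᴱ ∷ digit A ∷ []
    G00F00Eᴱ = digit G ∷ 𝟘ᴱ ∷ 𝟘ᴱ ∷ digit F ∷ 𝟘ᴱ ∷ 𝟘ᴱ ∷ 𝟙ᴱ ∷ []

    Checked : List Constraint → Set
    Checked cs = T (checkAll q a b cs)

    Certified : Set
    Certified =
      Checked (lhsᴱ ≐ rhsᴱ) × Checked (valueᴱ B0Aᴱ ≐ valueᴱ G00F00Eᴱ) ×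
      Checked (digitConditionsᴱ A) × Checked (digitConditionsᴱ B) × Checked (digitConditionsᴱ 𝟙-certificate) ×
      Checked (digitConditionsᴱ F) × Checked (digitConditionsᴱ G)

    digitsOf : ℤ → ℤ → ℤ → Digits5
    digitsOf Q α β =
      digits 𝟙 (⟦ digit A ⟧ᶻ Q α β) (⟦ digit F ⟧ᶻ Q α β) (⟦ digit B ⟧ᶻ Q α β) (⟦ digit G ⟧ᶻ Q α β)

    family-claim : Certified → ∀ s {Q α β} → Q ≡ ev q (+ s) → α ≡ ev a (+ s) → β ≡ ev b (+ s) →
                   Claim -1ℤ Q (digitsOf Q α β)
    family-claim (identity-ok , value-ok , A-ok , B-ok , E-ok , F-ok , G-ok) s refl refl refl =
      claim-intro { -1ℤ} {Q} {𝟙} {⟦ A ⟧ᵈ} {⟦ F ⟧ᵈ} {⟦ B ⟧ᵈ} {⟦ G ⟧ᵈ} identity same-value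
        (proj₁ A-digit) (proj₁ B-digit) (proj₁ E-digit) (proj₁ F-digit) (proj₁ G-digit)
        (proj₂ E-digit) (proj₂ F-digit) (proj₂ G-digit)
      where
      Q = ev q (+ s)
      α = ev a (+ s)
      β = ev b (+ s)
      ⟦_⟧ᵈ : DigitCertificate → Zτ
      ⟦ c ⟧ᵈ = ⟦ digit c ⟧ᶻ Q α β
      sound = checkAll-sound q a b s

      identity : mul -1ℤ Q ⟦ A ⟧ᵈ (pow -1ℤ Q τ 2) ⊕ ⟦ B ⟧ᵈ
                 ≡ (mul -1ℤ Q 𝟙 (pow -1ℤ Q τ 6) ⊕ mul -1ℤ Q ⟦ F ⟧ᵈ (pow -1ℤ Q τ 3)) ⊕ ⟦ G ⟧ᵈ
      identity = begin
        mul -1ℤ Q ⟦ A ⟧ᵈ (pow -1ℤ Q τ 2) ⊕ ⟦ B ⟧ᵈ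
          ≡⟨ cong (λ t → mul -1ℤ Q ⟦ A ⟧ᵈ t ⊕ ⟦ B ⟧ᵈ) (⟦⟧-pow Q α β τᴱ 2) ⟨
        ⟦ lhsᴱ ⟧ᶻ Q α β
          ≡⟨ ≐-sound lhsᴱ rhsᴱ (sound _ identity-ok) ⟩
        ⟦ rhsᴱ ⟧ᶻ Q α β
          ≡⟨ cong₂ (λ t u → (mul -1ℤ Q 𝟙 t ⊕ mul -1ℤ Q ⟦ F ⟧ᵈ u) ⊕ ⟦ G ⟧ᵈ)
                   (⟦⟧-pow Q α β τᴱ 6) (⟦⟧-pow Q α β τᴱ 3) ⟩
        (mul -1ℤ Q 𝟙 (pow -1ℤ Q τ 6) ⊕ mul -1ℤ Q ⟦ F ⟧ᵈ (pow -1ℤ Q τ 3)) ⊕ ⟦ G ⟧ᵈ ∎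
        where open ≡-Reasoning

      same-value : value -1ℤ Q (⟦ B ⟧ᵈ ∷ 𝟘 ∷ ⟦ A ⟧ᵈ ∷ []) ≡ value -1ℤ Q (spaced ⟦ G ⟧ᵈ ⟦ F ⟧ᵈ 𝟙)
      same-value = begin
        value -1ℤ Q (⟦ B ⟧ᵈ ∷ 𝟘 ∷ ⟦ A ⟧ᵈ ∷ [])  ≡⟨ ⟦⟧-value Q α β B0Aᴱ ⟨
        ⟦ valueᴱ B0Aᴱ ⟧ᶻ Q α β                ≡⟨ ≐-sound (valueᴱ B0Aᴱ) (valueᴱ G00F00Eᴱ) (sound _ value-ok) ⟩
        ⟦ valueᴱ G00F00Eᴱ ⟧ᶻ Q α β            ≡⟨ ⟦⟧-value Q α β G00F00Eᴱ ⟩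
        value -1ℤ Q (spaced ⟦ G ⟧ᵈ ⟦ F ⟧ᵈ 𝟙)   ∎
        where open ≡-Reasoning

      A-digit = digitConditions-sound A (sound _ A-ok)
      B-digit = digitConditions-sound B (sound _ B-ok)
      E-digit = digitConditions-sound 𝟙-certificate (sound _ E-ok)
      F-digit = digitConditions-sound F (sound _ F-ok)
      G-digit = digitConditions-sound G (sound _ G-ok)

  oddFamily : Family
  oddFamily = record
    { q = linear 3 2 ; a = linear 2 1 ; b = []
    ; A = certificate (mkᴱ ((:a :- con (+ 1)) :* :q :- con (+ 1)) (:q :- con (+ 1))) (:a :- con (+ 2)) (:q :- con (+ 1))
    ; F = certificate (mkᴱ (:a :- :q) (:q :- :a)) (con -1ℤ) :a
    ; B = certificate (mkᴱ (con (+ 1) :- :a) (:- :a)) (con -1ℤ) :a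
    ; G = certificate (mkᴱ (con (+ 1) :- :a) (:q :- :a)) (con -1ℤ) :a
    }

  evenFamily : Poly → Poly → Poly → Family
  evenFamily q a b = record
    { q = q ; a = a ; b = b
    ; A = certificate (mkᴱ ((:a :- con (+ 1)) :* :q :+ con (+ 1)) (:a :+ :b)) (:a :- con (+ 1)) (con (+ 1))
    ; F = certificate (mkᴱ (:- :q :+ :b) (:q :- :a :- con (+ 1))) (con -1ℤ) :b
    ; B = certificate (mkᴱ (:- (:a :* :q) :+ con (+ 1)) (:- :a)) (:- :a) (con (+ 1))
    ; G = certificate (mkᴱ ((:a :- con (+ 1)) :* :q :+ con (+ 1)) (:a :- con (+ 1))) (:a :- con (+ 1)) (con (+ 1))
    }

module Parameters where

  open import Data.Nat using (suc; _+_; _*_; _/_; _<_; s≤s; z≤n)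
  open import Data.Nat.DivMod using (/-congˡ; +-distrib-/-∣ˡ; m*n/n≡m; m<n⇒m/n≡0)
  open import Data.Nat.Divisibility using (n∣m*n)
  open import Data.Nat.Properties using (+-identityʳ; m≤m+n)
  open import Data.Nat.Tactic.RingSolver using (solve-∀)
  open import Defs using (cdiv; aOf; bOf)
  open import Relation.Binary.PropositionalEquality

  cdiv-≡ : ∀ m k t r → m + k ≡ t * suc k + r → r < suc k → cdiv m (suc k) ≡ t
  cdiv-≡ m k t r m+k≡ r<1+k = begin
    (m + k) / suc k               ≡⟨ /-congˡ m+k≡ ⟩
    (t * suc k + r) / suc k       ≡⟨ +-distrib-/-∣ˡ r (n∣m*n t) ⟩
    t * suc k / suc k + r / suc k ≡⟨ cong₂ _+_ (m*n/n≡m t (suc k)) (m<n⇒m/n≡0 r<1+k) ⟩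
    t + 0                         ≡⟨ +-identityʳ t ⟩
    t                             ∎
    where open ≡-Reasoning

  aOf-even : ∀ m → aOf (m * 2) ≡ m
  aOf-even m = cdiv-≡ (m * 2) 1 m 1 refl (s≤s (s≤s z≤n))

  aOf-odd : ∀ m → aOf (suc (m * 2)) ≡ suc m
  aOf-odd m = cdiv-≡ (suc (m * 2)) 1 (suc m) 0 (eq m) (s≤s z≤n)
    where
    eq : ∀ m → suc (m * 2) + 1 ≡ suc m * 2 + 0
    eq = solve-∀

  -- 6q - 2 = 1 + k, and r < 1 + k is witnessed by k = r + e.
  bOf-≡ : ∀ q k t r e → 6 * q ≡ 3 + k → q * q + k ≡ t * suc k + r → k ≡ r + e → bOf q ≡ t
  bOf-≡ q k t r e 6q≡3+k q²+k≡ refl rewrite 6q≡3+k = cdiv-≡ (q * q) (r + e) t r q²+k≡ (s≤s (m≤m+n r e))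

  bOf-6+6s : ∀ s → bOf (6 + s * 6) ≡ 2 + s
  bOf-6+6s s = bOf-≡ (6 + s * 6) (33 + s * 36) (2 + s) (1 + s * 2) (32 + s * 34) (eq₁ s) (eq₂ s) (eq₃ s)
    where
    eq₁ : ∀ s → 6 * (6 + s * 6) ≡ 3 + (33 + s * 36)
    eq₁ = solve-∀
    eq₂ : ∀ s → (6 + s * 6) * (6 + s * 6) + (33 + s * 36) ≡ (2 + s) * suc (33 + s * 36) + (1 + s * 2)
    eq₂ = solve-∀
    eq₃ : ∀ s → 33 + s * 36 ≡ (1 + s * 2) + (32 + s * 34)
    eq₃ = solve-∀

  bOf-8+6s : ∀ s → bOf (8 + s * 6) ≡ 2 + s
  bOf-8+6s s = bOf-≡ (8 + s * 6) (45 + s * 36) (2 + s) (17 + s * 14) (28 + s * 22) (eq₁ s) (eq₂ s) (eq₃ s)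
    where
    eq₁ : ∀ s → 6 * (8 + s * 6) ≡ 3 + (45 + s * 36)
    eq₁ = solve-∀
    eq₂ : ∀ s → (8 + s * 6) * (8 + s * 6) + (45 + s * 36) ≡ (2 + s) * suc (45 + s * 36) + (17 + s * 14)
    eq₂ = solve-∀
    eq₃ : ∀ s → 45 + s * 36 ≡ (17 + s * 14) + (28 + s * 22)
    eq₃ = solve-∀

  bOf-4+6s : ∀ s → bOf (4 + s * 6) ≡ 1 + s
  bOf-4+6s s = bOf-≡ (4 + s * 6) (21 + s * 36) (1 + s) (15 + s * 26) (6 + s * 10) (eq₁ s) (eq₂ s) (eq₃ s)
    where
    eq₁ : ∀ s → 6 * (4 + s * 6) ≡ 3 + (21 + s * 36)
    eq₁ = solve-∀
    eq₂ : ∀ s → (4 + s * 6) * (4 + s * 6) + (21 + s * 36) ≡ (1 + s) * suc (21 + s * 36) + (15 + s * 26)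
    eq₂ = solve-∀
    eq₃ : ∀ s → 21 + s * 36 ≡ (15 + s * 26) + (6 + s * 10)
    eq₃ = solve-∀

module Cases where

  open Polynomial using (ev; linear; ev-linear)
  open Certification using (family-claim; oddFamily; evenFamily)
  open Parameters
  open import Data.Integer using (+_; -1ℤ)
  open import Data.Nat using (ℕ; zero; suc; _+_; _*_; _<_; _≤_; s≤s)
  open import Data.Nat.Tactic.RingSolver using (solve-∀)
  open import Data.Product using (_,_)
  open import Data.Unit using (tt)
  open import Defs using (Claim; digitsOdd; digitsEven; aOf)
  open import Relation.Binary.PropositionalEquality

  OddClaim EvenClaim : ℕ → Set
  OddClaim q  = Claim -1ℤ (+ q) (digitsOdd q)
  EvenClaim q = Claim -1ℤ (+ q) (digitsEven q)

  as-linear : ∀ {n} c k s → n ≡ c + s * k → + n ≡ ev (linear c k) (+ s)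
  as-linear c k s refl = sym (ev-linear c k s)

  odd-3+2s : ∀ s → OddClaim (3 + s * 2)
  odd-3+2s s = family-claim oddFamily (tt , tt , tt , tt , tt , tt , tt) s
    (as-linear 3 2 s refl) (as-linear 2 1 s (trans (aOf-odd (suc s)) (eq s))) refl
    where
    eq : ∀ s → suc (suc s) ≡ 2 + s * 1
    eq = solve-∀

  even-6+6s : ∀ s → EvenClaim (6 + s * 6)
  even-6+6s s = family-claim (evenFamily (linear 6 6) (linear 3 3) (linear 2 1)) (tt , tt , tt , tt , tt , tt , tt) s
    (as-linear 6 6 s refl) (as-linear 3 3 s (trans (cong aOf (eq₁ s)) (aOf-even (3 + s * 3))))
    (as-linear 2 1 s (trans (bOf-6+6s s) (eq₂ s)))
    where
    eq₁ : ∀ s → 6 + s * 6 ≡ (3 + s * 3) * 2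
    eq₁ = solve-∀
    eq₂ : ∀ s → 2 + s ≡ 2 + s * 1
    eq₂ = solve-∀

  even-8+6s : ∀ s → EvenClaim (8 + s * 6)
  even-8+6s s = family-claim (evenFamily (linear 8 6) (linear 4 3) (linear 2 1)) (tt , tt , tt , tt , tt , tt , tt) s
    (as-linear 8 6 s refl) (as-linear 4 3 s (trans (cong aOf (eq₁ s)) (aOf-even (4 + s * 3))))
    (as-linear 2 1 s (trans (bOf-8+6s s) (eq₂ s)))
    where
    eq₁ : ∀ s → 8 + s * 6 ≡ (4 + s * 3) * 2
    eq₁ = solve-∀
    eq₂ : ∀ s → 2 + s ≡ 2 + s * 1
    eq₂ = solve-∀

  even-4+6s : ∀ s → EvenClaim (4 + s * 6)
  even-4+6s s = family-claim (evenFamily (linear 4 6) (linear 2 3) (linear 1 1)) (tt , tt , tt , tt , tt , tt , tt) s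
    (as-linear 4 6 s refl) (as-linear 2 3 s (trans (cong aOf (eq₁ s)) (aOf-even (2 + s * 3))))
    (as-linear 1 1 s (trans (bOf-4+6s s) (eq₂ s)))
    where
    eq₁ : ∀ s → 4 + s * 6 ≡ (2 + s * 3) * 2
    eq₁ = solve-∀
    eq₂ : ∀ s → 1 + s ≡ 1 + s * 1
    eq₂ = solve-∀

  odd-case : ∀ m → 3 ≤ suc (m * 2) → OddClaim (suc (m * 2))
  odd-case zero    (s≤s ())
  odd-case (suc s) _ = odd-3+2s s

  even-case : ∀ r j → r < 3 → 3 ≤ (r + j * 3) * 2 → EvenClaim ((r + j * 3) * 2)
  even-case 0 zero    _ ()
  even-case 0 (suc s) _ _ = subst EvenClaim (eq s) (even-6+6s s)
    where
    eq : ∀ s → 6 + s * 6 ≡ (0 + suc s * 3) * 2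
    eq = solve-∀
  even-case 1 zero    _ (s≤s (s≤s ()))
  even-case 1 (suc s) _ _ = subst EvenClaim (eq s) (even-8+6s s)
    where
    eq : ∀ s → 8 + s * 6 ≡ (1 + suc s * 3) * 2
    eq = solve-∀
  even-case 2 j _ _ = subst EvenClaim (eq j) (even-4+6s j)
    where
    eq : ∀ j → 4 + j * 6 ≡ (2 + j * 3) * 2
    eq = solve-∀
  even-case (suc (suc (suc _))) _ (s≤s (s≤s (s≤s ()))) _

open import Defs
open import Data.Nat using (ℕ; _≤_; _%_; _+_; _*_; _/_)
open import Data.Nat.DivMod using (m≡m%n+[m/n]*n; m%n<n)
open import Data.Integer using (-[1+_]; +_)
open import Data.Product using (_×_; _,_)
open import Relation.Binary.PropositionalEquality using (_≡_; sym; trans; cong; subst)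
open Cases using (OddClaim; EvenClaim; odd-case; even-case)

proposition13p4 : (q : ℕ) → 3 ≤ q →
    ((q % 2 ≡ 1 → Claim -[1+ 0 ] (+ q) (digitsOdd q))
      × (q % 2 ≡ 0 → Claim -[1+ 0 ] (+ q) (digitsEven q)))
proposition13p4 q 3≤q = odd , even
  where
  m = q / 2

  q≡q%2+m*2 : q ≡ q % 2 + m * 2
  q≡q%2+m*2 = m≡m%n+[m/n]*n q 2

  odd : q % 2 ≡ 1 → OddClaim q
  odd q%2≡1 = subst OddClaim (sym q≡1+m*2) (odd-case m (subst (3 ≤_) q≡1+m*2 3≤q))
    where
    q≡1+m*2 : q ≡ 1 + m * 2
    q≡1+m*2 = trans q≡q%2+m*2 (cong (_+ m * 2) q%2≡1)

  even : q % 2 ≡ 0 → EvenClaim q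
  even q%2≡0 =
    subst EvenClaim (sym q≡[r+3j]*2) (even-case (m % 3) (m / 3) (m%n<n m 3) (subst (3 ≤_) q≡[r+3j]*2 3≤q))
    where
    q≡[r+3j]*2 : q ≡ (m % 3 + m / 3 * 3) * 2
    q≡[r+3j]*2 = trans q≡q%2+m*2 (trans (cong (_+ m * 2) q%2≡0) (cong (_* 2) (m≡m%n+[m/n]*n m 3)))
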